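{- Let $\Delta\geq 3$ be an integer and let $G$ be a $\Delta$-regular graph of order $n$. Then (i) $\gamma_e(G)\geq \frac{\Delta n}{4\Delta-2}$, and (ii) if $G$ is claw-free, then $\gamma_e(G)\geq \frac{\Delta n}{2\Delta+4}$.
   Context: All graphs are finite, simple and undirected. A matching $M$ in $G$ is maximal if it is maximal with respect to inclusion among matchings. The edge domination number $\gamma_e(G)$ is the minimum size of a maximal matching in $G$. A graph is claw-free if it has no induced subgraph isomorphic to $K_{1,3}$. -}

module Defs where

open import Data.Nat using (ℕ; _*_; _≤_)
open import Data.Fin using (Fin)
open import Data.Bool using (Bool; true; false)
open import Data.List using (List; length; filter; concatMap; _∷_; [])
open import Data.List.Membership.Propositional using (_∈_)
open import Data.List.Relation.Unary.Unique.Propositional using (Unique)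
open import Data.List.Relation.Unary.Any using (Any)
open import Data.Vec.Functional using () 
open import Data.Fin.Subset using (Subset; ∣_∣)
open import Data.Vec using (tabulate)
open import Data.Product using (_×_; _,_; proj₁; proj₂)
open import Data.Sum using (_⊎_)
open import Relation.Binary.PropositionalEquality using (_≡_; _≢_)
open import Relation.Nullary using (¬_)

record Graph (n : ℕ) : Set where
  field
    adj   : Fin n → Fin n → Bool
    sym   : ∀ u v → adj u v ≡ adj v u
    irrefl : ∀ v → adj v v ≡ false

open Graph public

Adj : ∀ {n} → Graph n → Fin n → Fin n → Set
Adj G u v = adj G u v ≡ true

nbhd : ∀ {n} → Graph n → Fin n → Subset n
nbhd G v = tabulate (adj G v)

degree : ∀ {n} → Graph n → Fin n → ℕ
degree G v = ∣ nbhd G v ∣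

Regular : ∀ {n} → ℕ → Graph n → Set
Regular Δ G = ∀ v → degree G v ≡ Δ

endpoints : ∀ {n} → List (Fin n × Fin n) → List (Fin n)
endpoints = concatMap (λ e → proj₁ e ∷ proj₂ e ∷ [])

-- A matching: a list of edges of G whose endpoints are pairwise distinct
-- (so edges are pairwise disjoint and no edge is repeated). Its size is
-- the length of the list.
record IsMatching {n} (G : Graph n) (M : List (Fin n × Fin n)) : Set where
  field
    edges    : ∀ {u v} → (u , v) ∈ M → Adj G u v
    disjoint : Unique (endpoints M)

-- Maximal w.r.t. inclusion: no edge of G can be added, i.e. every edge
-- of G has an endpoint covered by M.
IsMaximalMatching : ∀ {n} → Graph n → List (Fin n × Fin n) → Set
IsMaximalMatching G M =
  IsMatching G M ×
  (∀ u v → Adj G u v → (u ∈ endpoints M) ⊎ (v ∈ endpoints M))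

ClawFree : ∀ {n} → Graph n → Set
ClawFree G = ∀ v a b c →
  Adj G v a → Adj G v b → Adj G v c →
  a ≢ b → b ≢ c → a ≢ c →
  ¬ (adj G a b ≡ false × adj G b c ≡ false × adj G a c ≡ false)

-- γ_e(G) ≥ p / q  (q > 0), i.e. every maximal matching M has
-- |M| ≥ p/q, written without division as p ≤ q * |M|.
-- Since γ_e(G) is the minimum size of a maximal matching (and maximal
-- matchings always exist), this is exactly γ_e(G) ≥ p/q.
EdgeDomLowerBound : ∀ {n} → Graph n → ℕ → ℕ → Set
EdgeDomLowerBound G p q =
  ∀ M → IsMaximalMatching G M → p ≤ q * length M

-- Let M be a maximal matching of a Δ-regular graph G on n vertices, let
-- S be the set of vertices covered by M and U the remaining vertices.
-- Maximality says exactly that S is a vertex cover, i.e. U is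
-- independent, so every vertex of U sends all of its Δ edges into S.
-- If every vertex of S has at most k neighbours in U, double counting
-- the U–S edges gives Δ|U| ≤ k|S|, hence
--   Δn = Δ(|U| + |S|) ≤ (k + Δ)|S| ≤ (k + Δ)·2|M|.
--   (i)  k = Δ - 1 always works: each v ∈ S has its matching partner in S.
--   (ii) k = 2 works for claw-free G: three neighbours of v in the
--        independent set U would form a claw centred at v.
module Submission where

open import Defs hiding (sym)
open import Data.Nat using (ℕ; zero; suc; _≤_; _*_; _+_; _∸_; z≤n; s≤s; s≤s⁻¹; _≤?_)
open import Data.Nat.Properties hiding (_≟_)
open import Data.Nat.Tactic.RingSolver using (solve-∀)
open import Data.Product using (_×_; _,_; proj₁; proj₂; Σ-syntax)
open import Data.Sum using (inj₁; inj₂)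
open import Data.Fin using (Fin; zero; suc)
open import Data.Fin.Properties using (_≟_)
open import Data.Fin.Subset using (∣_∣)
open import Data.Bool using (Bool; true; false; _∧_; not)
open import Data.List using (List; []; _∷_; length)
open import Data.List.Membership.Propositional using (_∈_)
open import Data.List.Relation.Unary.Any using (here; there; any?)
open import Data.Vec using (tabulate)
open import Function using (_∘_)
open import Relation.Nullary using (yes; no; does; contradiction)
open import Relation.Binary.PropositionalEquality
open import Algebra.Properties.CommutativeSemigroup +-commutativeSemigroup
  using (x∙yz≈y∙xz)
open import Algebra.Properties.CommutativeMonoid.Sum +-0-commutativeMonoid
  using (sum; sum-replicate-zero; sum-cong-≗; ∑-comm)
open import Algebra.Properties.Semiring.Sum +-*-semiring using (*-distribʳ-sum)

⟦_⟧ : Bool → ℕ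
⟦ true ⟧  = 1
⟦ false ⟧ = 0

⟦⟧≤1 : ∀ b → ⟦ b ⟧ ≤ 1
⟦⟧≤1 true  = ≤-refl
⟦⟧≤1 false = z≤n

sum-mono : ∀ {n} {f g : Fin n → ℕ} → (∀ i → f i ≤ g i) → sum f ≤ sum g
sum-mono {zero}  f≤g = z≤n
sum-mono {suc n} f≤g = +-mono-≤ (f≤g zero) (sum-mono (f≤g ∘ suc))

count : ∀ {n} → (Fin n → Bool) → ℕ
count p = sum (λ i → ⟦ p i ⟧)

∣tabulate∣≡count : ∀ {n} (p : Fin n → Bool) → ∣ tabulate p ∣ ≡ count p
∣tabulate∣≡count {zero}  p = refl
∣tabulate∣≡count {suc n} p with p zero
... | true  = cong suc (∣tabulate∣≡count (p ∘ suc))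
... | false = ∣tabulate∣≡count (p ∘ suc)

count-false : ∀ {n} → count {n} (λ _ → false) ≡ 0
count-false {n} = sum-replicate-zero n

count-mono : ∀ {n} {p q : Fin n → Bool} →
  (∀ i → p i ≡ true → q i ≡ true) → count p ≤ count q
count-mono {p = p} {q} p⇒q = sum-mono indicator-mono
  where
  indicator-mono : ∀ i → ⟦ p i ⟧ ≤ ⟦ q i ⟧
  indicator-mono i with p i in pᵢ
  ... | false = z≤n
  ... | true rewrite p⇒q i pᵢ = ≤-refl

count-complement : ∀ {n} (p : Fin n → Bool) → count (not ∘ p) + count p ≡ n
count-complement {zero}  p = refl
count-complement {suc n} p with p zero
... | true  = trans (+-suc _ _) (cong suc (count-complement (p ∘ suc)))
... | false = cong suc (count-complement (p ∘ suc))

_─_ : ∀ {n} → (Fin n → Bool) → Fin n → (Fin n → Bool)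
(p ─ a) i = not (does (i ≟ a)) ∧ p i

─-sound : ∀ {n} (p : Fin n → Bool) a i → (p ─ a) i ≡ true → p i ≡ true × i ≢ a
─-sound p a i pᵢ with i ≟ a
... | yes _   = contradiction pᵢ λ ()
... | no i≢a = pᵢ , i≢a

count-─ : ∀ {n} (p : Fin n → Bool) a → count p ≡ ⟦ p a ⟧ + count (p ─ a)
count-─ {suc n} p zero    = refl
count-─ {suc n} p (suc a) =
  trans (cong (⟦ p zero ⟧ +_) (count-─ (p ∘ suc) a))
        (x∙yz≈y∙xz ⟦ p zero ⟧ ⟦ p (suc a) ⟧ (count ((p ∘ suc) ─ a)))

witness : ∀ {n} (p : Fin n → Bool) → 1 ≤ count p → Σ[ a ∈ Fin n ] p a ≡ true
witness {suc n} p pos with p zero in p₀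
... | true  = zero , p₀
... | false with witness (p ∘ suc) pos
...   | a , pa = suc a , pa

pick : ∀ {n} (p : Fin n → Bool) {k} → suc k ≤ count p →
  Σ[ a ∈ Fin n ] (p a ≡ true × k ≤ count (p ─ a))
pick p {k} many with witness p (≤-trans (s≤s z≤n) many)
... | a , pa = a , pa , s≤s⁻¹ (subst (suc k ≤_) split many)
  where
  split : count p ≡ 1 + count (p ─ a)
  split = trans (count-─ p a) (cong (λ b → ⟦ b ⟧ + count (p ─ a)) pa)

three-distinct : ∀ {n} (p : Fin n → Bool) → 3 ≤ count p →
  Σ[ a ∈ Fin n ] Σ[ b ∈ Fin n ] Σ[ c ∈ Fin n ]
    (p a ≡ true × p b ≡ true × p c ≡ true × a ≢ b × b ≢ c × a ≢ c)
three-distinct p three with pick p three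
... | a , pa , two with pick (p ─ a) two
... | b , p─a-b , one with pick ((p ─ a) ─ b) one
... | c , p─a─b-c , _ with ─-sound p a b p─a-b | ─-sound (p ─ a) b c p─a─b-c
... | pb , b≢a | p─a-c , c≢b with ─-sound p a c p─a-c
... | pc , c≢a = a , b , c , pa , pb , pc , ≢-sym b≢a , ≢-sym c≢b , ≢-sym c≢a

count-≤-length : ∀ {n} (p : Fin n → Bool) (L : List (Fin n)) →
  (∀ i → p i ≡ true → i ∈ L) → count p ≤ length L
count-≤-length {n} p [] p⊆L = ≤-trans (count-mono nowhere) (≤-reflexive (count-false {n}))
  where
  nowhere : ∀ i → p i ≡ true → false ≡ true
  nowhere i pᵢ with () ← p⊆L i pᵢ
count-≤-length p (x ∷ L) p⊆x∷L = begin
    count p                 ≡⟨ count-─ p x ⟩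
    ⟦ p x ⟧ + count (p ─ x) ≤⟨ +-mono-≤ (⟦⟧≤1 (p x)) (count-≤-length (p ─ x) L p─x⊆L) ⟩
    1 + length L            ∎
  where
  open ≤-Reasoning
  p─x⊆L : ∀ i → (p ─ x) i ≡ true → i ∈ L
  p─x⊆L i p─xᵢ with ─-sound p x i p─xᵢ
  ... | pᵢ , i≢x with p⊆x∷L i pᵢ
  ...   | here i≡x  = contradiction i≡x i≢x
  ...   | there i∈L = i∈L

regular-count : ∀ {n} (G : Graph n) {Δ} → Regular Δ G → ∀ v → count (adj G v) ≡ Δ
regular-count G regular v = trans (sym (∣tabulate∣≡count (adj G v))) (regular v)

nbrsIn : ∀ {n} → Graph n → (Fin n → Bool) → Fin n → Fin n → Bool
nbrsIn G I v u = I u ∧ adj G v u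

nbrsIn-sound : ∀ {n} (G : Graph n) I v u →
  nbrsIn G I v u ≡ true → I u ≡ true × Adj G v u
nbrsIn-sound G I v u N with I u
... | true = refl , N

VertexCover : ∀ {n} → Graph n → (Fin n → Bool) → Set
VertexCover G s = ∀ u v → Adj G u v → s u ≡ false → s v ≡ true

module _ {n} (G : Graph n) {Δ} (regular : Regular Δ G)
         (s : Fin n → Bool) (cover : VertexCover G s)
         (k : ℕ) (few : ∀ v → s v ≡ true → count (nbrsIn G (not ∘ s) v) ≤ k) where

  -- A vertex outside s has all its Δ neighbours in s.
  outside-degree : ∀ u → sum (λ v → ⟦ nbrsIn G (not ∘ s) v u ⟧) ≡ ⟦ not (s u) ⟧ * Δ
  outside-degree u with s u
  ... | true  = count-false {n}
  ... | false = begin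
      sum (λ v → ⟦ adj G v u ⟧) ≡⟨ sum-cong-≗ (λ v → cong ⟦_⟧ (Graph.sym G v u)) ⟩
      count (adj G u)           ≡⟨ regular-count G regular u ⟩
      Δ                         ≡⟨ +-identityʳ Δ ⟨
      1 * Δ                     ∎
    where open ≡-Reasoning

  outside-nbrs : ∀ v → count (nbrsIn G (not ∘ s) v) ≤ ⟦ s v ⟧ * k
  outside-nbrs v with s v in sᵥ
  ... | true  = ≤-trans (few v sᵥ) (≤-reflexive (sym (+-identityʳ k)))
  ... | false = ≤-trans (count-mono none) (≤-reflexive (count-false {n}))
    where
    none : ∀ u → nbrsIn G (not ∘ s) v u ≡ true → false ≡ true
    none u N with s u in sᵤ | nbrsIn-sound G (not ∘ s) v u N
    ... | true  | ()
    ... | false | _ , vu = trans (sym sᵤ) (cover v u vu sᵥ)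

  -- Both sides count the edges between s and its complement.
  cover-double-count : Δ * count (not ∘ s) ≤ k * count s
  cover-double-count = begin
    Δ * count (not ∘ s)                            ≡⟨ *-comm Δ _ ⟩
    count (not ∘ s) * Δ                            ≡⟨ *-distribʳ-sum Δ (λ u → ⟦ not (s u) ⟧) ⟩
    sum (λ u → ⟦ not (s u) ⟧ * Δ)                  ≡⟨ sum-cong-≗ outside-degree ⟨
    sum (λ u → sum (λ v → ⟦ nbrsIn G (not ∘ s) v u ⟧)) ≡⟨ ∑-comm (λ u v → ⟦ nbrsIn G (not ∘ s) v u ⟧) ⟩
    sum (λ v → count (nbrsIn G (not ∘ s) v))       ≤⟨ sum-mono outside-nbrs ⟩
    sum (λ v → ⟦ s v ⟧ * k)                        ≡⟨ *-distribʳ-sum k (λ v → ⟦ s v ⟧) ⟨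
    count s * k                                    ≡⟨ *-comm _ k ⟩
    k * count s                                    ∎
    where open ≤-Reasoning

  cover-bound : Δ * n ≤ (k + Δ) * count s
  cover-bound = begin
    Δ * n                                 ≡⟨ cong (Δ *_) (count-complement s) ⟨
    Δ * (count (not ∘ s) + count s)       ≡⟨ *-distribˡ-+ Δ _ _ ⟩
    Δ * count (not ∘ s) + Δ * count s     ≤⟨ +-monoˡ-≤ _ cover-double-count ⟩
    k * count s + Δ * count s             ≡⟨ *-distribʳ-+ (count s) k Δ ⟨
    (k + Δ) * count s                     ∎
    where open ≤-Reasoning

nbrs-outside-≤ : ∀ {n} (G : Graph n) s v p → s p ≡ true → Adj G v p →
  count (nbrsIn G (not ∘ s) v) ≤ count (adj G v) ∸ 1
nbrs-outside-≤ G s v p sₚ vp = begin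
    count (nbrsIn G (not ∘ s) v) ≤⟨ count-mono outside⇒not-p ⟩
    count (adj G v ─ p)          ≡⟨ cong (_∸ 1) split ⟨
    count (adj G v) ∸ 1          ∎
  where
  open ≤-Reasoning
  split : count (adj G v) ≡ 1 + count (adj G v ─ p)
  split = trans (count-─ (adj G v) p) (cong (λ b → ⟦ b ⟧ + count (adj G v ─ p)) vp)
  outside⇒not-p : ∀ u → nbrsIn G (not ∘ s) v u ≡ true → (adj G v ─ p) u ≡ true
  outside⇒not-p u N with nbrsIn-sound G (not ∘ s) v u N | u ≟ p
  ... | s̸ᵤ , _ | yes refl = contradiction (subst (λ b → not b ≡ true) sₚ s̸ᵤ) λ ()
  ... | _ , vu | no _     = vu

Independent : ∀ {n} → Graph n → (Fin n → Bool) → Set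
Independent G I = ∀ a b → I a ≡ true → I b ≡ true → adj G a b ≡ false

cover⇒independent : ∀ {n} (G : Graph n) s → VertexCover G s → Independent G (not ∘ s)
cover⇒independent G s cover a b a∉s b∉s with adj G a b in ab | s a in sa | s b in sb
... | false | _     | _     = refl
... | true  | true  | _     = contradiction a∉s λ ()
... | true  | false | true  = contradiction b∉s λ ()
... | true  | false | false = contradiction (trans (sym sb) (cover a b ab sa)) λ ()

-- In a claw-free graph a vertex has at most two neighbours in an
-- independent set: three would be the leaves of a claw.
claw-free-nbrs : ∀ {n} (G : Graph n) → ClawFree G → ∀ I → Independent G I →
  ∀ v → count (nbrsIn G I v) ≤ 2
claw-free-nbrs G clawFree I independent v with count (nbrsIn G I v) ≤? 2
... | yes atMostTwo = atMostTwo
... | no moreThanTwo with three-distinct (nbrsIn G I v) (≰⇒> moreThanTwo)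
... | a , b , c , Na , Nb , Nc , a≢b , b≢c , a≢c
  with nbrsIn-sound G I v a Na | nbrsIn-sound G I v b Nb | nbrsIn-sound G I v c Nc
... | Ia , va | Ib , vb | Ic , vc =
  contradiction (independent a b Ia Ib , independent b c Ib Ic , independent a c Ia Ic)
                (clawFree v a b c va vb vc a≢b b≢c a≢c)

partner : ∀ {n} (G : Graph n) (M : List (Fin n × Fin n)) →
  (∀ {u v} → (u , v) ∈ M → Adj G u v) →
  ∀ v → v ∈ endpoints M → Σ[ p ∈ Fin n ] (p ∈ endpoints M × Adj G v p)
partner G ((a , b) ∷ M) edges v (here refl)         = b , there (here refl) , edges (here refl)
partner G ((a , b) ∷ M) edges v (there (here refl)) =
  a , here refl , trans (Graph.sym G b a) (edges (here refl))
partner G ((a , b) ∷ M) edges v (there (there v∈M)) with partner G M (edges ∘ there) v v∈M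
... | p , p∈M , vp = p , there (there p∈M) , vp

length-endpoints : ∀ {n} (M : List (Fin n × Fin n)) → length (endpoints M) ≡ 2 * length M
length-endpoints []      = refl
length-endpoints (_ ∷ M) = trans (cong (2 +_) (length-endpoints M)) (sym (*-distribˡ-+ 2 1 (length M)))

module MaximalMatching {n} {G : Graph n} {Δ} (regular : Regular Δ G)
                       {M : List (Fin n × Fin n)} (maximal : IsMaximalMatching G M) where

  covered : Fin n → Bool
  covered v = does (any? (v ≟_) (endpoints M))

  covered-sound : ∀ v → covered v ≡ true → v ∈ endpoints M
  covered-sound v c with any? (v ≟_) (endpoints M)
  ... | yes v∈M = v∈M
  ... | no _    = contradiction c λ ()

  covered-complete : ∀ v → v ∈ endpoints M → covered v ≡ true
  covered-complete v v∈M with any? (v ≟_) (endpoints M)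
  ... | yes _   = refl
  ... | no v∉M = contradiction v∈M v∉M

  covered-cover : VertexCover G covered
  covered-cover u v uv uncovered with proj₂ maximal u v uv
  ... | inj₁ u∈M = contradiction (trans (sym uncovered) (covered-complete u u∈M)) λ ()
  ... | inj₂ v∈M = covered-complete v v∈M

  covered-count : count covered ≤ 2 * length M
  covered-count = ≤-trans (count-≤-length covered (endpoints M) covered-sound)
                          (≤-reflexive (length-endpoints M))

  matching-bound : ∀ k → (∀ v → covered v ≡ true → count (nbrsIn G (not ∘ covered) v) ≤ k) →
    Δ * n ≤ (k + Δ) * (2 * length M)
  matching-bound k few = ≤-trans (cover-bound G regular covered covered-cover k few)
                                 (*-monoʳ-≤ (k + Δ) covered-count)

  -- k = Δ - 1: a covered vertex has its matching partner among the covered ones.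
  partner-bound : ∀ v → covered v ≡ true → count (nbrsIn G (not ∘ covered) v) ≤ Δ ∸ 1
  partner-bound v c
    with partner G M (IsMatching.edges (proj₁ maximal)) v (covered-sound v c)
  ... | p , p∈M , vp =
    subst (λ d → count (nbrsIn G (not ∘ covered) v) ≤ d ∸ 1) (regular-count G regular v)
          (nbrs-outside-≤ G covered v p (covered-complete p p∈M) vp)

  claw-bound : ClawFree G → ∀ v → count (nbrsIn G (not ∘ covered) v) ≤ 2
  claw-bound clawFree =
    claw-free-nbrs G clawFree (not ∘ covered) (cover⇒independent G covered covered-cover)

coefficient-general : ∀ Δ m → 1 ≤ Δ → (Δ ∸ 1 + Δ) * (2 * m) ≡ (4 * Δ ∸ 2) * m
coefficient-general (suc d) m _ =
  trans (expand d m) (cong (λ x → (x ∸ 2) * m) (sym (quadruple d)))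
  where
  expand : ∀ d m → (d + suc d) * (2 * m) ≡ (2 + 4 * d) * m
  expand = solve-∀
  quadruple : ∀ d → 4 * suc d ≡ 2 + (2 + 4 * d)
  quadruple = solve-∀

coefficient-claw-free : ∀ Δ m → (2 + Δ) * (2 * m) ≡ (2 * Δ + 4) * m
coefficient-claw-free = solve-∀

-- The theorem: k = Δ - 1 in general, k = 2 for claw-free graphs.
lemma9 : (Δ : ℕ) → 3 ≤ Δ → (n : ℕ) → (G : Graph n) → Regular Δ G →
    EdgeDomLowerBound G (Δ * n) (4 * Δ ∸ 2) ×
    (ClawFree G → EdgeDomLowerBound G (Δ * n) (2 * Δ + 4))
lemma9 Δ 3≤Δ n G regular = general , claw-free
  where
  open MaximalMatching regular

  general : EdgeDomLowerBound G (Δ * n) (4 * Δ ∸ 2)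
  general M maximal =
    ≤-trans (matching-bound maximal (Δ ∸ 1) (partner-bound maximal))
            (≤-reflexive (coefficient-general Δ (length M) (≤-trans (s≤s z≤n) 3≤Δ)))

  claw-free : ClawFree G → EdgeDomLowerBound G (Δ * n) (2 * Δ + 4)
  claw-free clawFree M maximal =
    ≤-trans (matching-bound maximal 2 (λ v _ → claw-bound maximal clawFree v))
            (≤-reflexive (coefficient-claw-free Δ (length M)))
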